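{- Let $\mathcal{N}$ be a $d$-dimensional invertible affine net and $t\in\mathbb{N}^d$. Let $D_0=\mathbb{N}^d\setminus{\uparrow}\{t\}$ and $D_{k+1}=D_k\cap\mathrm{Pre}_\forall(D_k)$, and consider the resulting descending chain $D_0\supsetneq D_1\supsetneq\cdots$ (up to stabilisation). This chain is strongly monotone.
   Context: A $d$-dimensional affine net is a finite set $\mathcal{N}$ of triples $(a,A,b)\in\mathbb{N}^d\times\mathbb{N}^{d\times d}\times\mathbb{N}^d$; it defines transitions $u\to A\cdot(u-a)+b$ for $u\in\mathbb{N}^d$ and $(a,A,b)\in\mathcal{N}$ with $u-a\in\mathbb{N}^d$. It is invertible if every matrix $A$ occurring in it is invertible over $\mathbb{Q}$. $\mathbb{N}^d$ is ordered componentwise by $\sqsubseteq$; ${\uparrow}S$ is the upward closure. $\mathrm{Pre}_\forall(S)=\{x\in\mathbb{N}^d: \forall y\,(x\to y\Rightarrow y\in S)\}$. Order ideals of $\mathbb{N}^d$ (non-empty directed downwards-closed sets) are identified with vectors $v\in(\mathbb{N}\cup\{\omega\})^d$ via $\{x: x\sqsubseteq v\}$; $\dim I=|\{i: I(i)=\omega\}|$. Each downwards-closed $D$ is uniquely a finite union of pairwise incomparable ideals (canonical decomposition); $I\in D$ means $I$ belongs to it. An ideal $I$ is proper at step $k$ if $I\in D_k$ and $I\notin D_{k+1}$. The chain is strongly monotone if whenever $I$ is proper at step $k+1$ there is $I'$ proper at step $k$ with $\dim I\le\dim I'$. -}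

module Defs where

open import Data.Nat using (ℕ; zero; suc; _+_; _*_; _∸_; _≤_)
open import Data.Fin using (Fin)
open import Data.Vec using (Vec; []; _∷_; lookup; tabulate; zipWith; sum; map; foldr′)
open import Data.List using (List)
open import Data.List.Membership.Propositional using (_∈_)
open import Data.List.Relation.Unary.Any using (Any)
open import Data.List.Relation.Unary.AllPairs using (AllPairs)
open import Data.Product using (Σ; _×_; _,_; ∃)
open import Data.Integer using (+_)
open import Data.Rational as ℚ using (ℚ; 0ℚ; 1ℚ)
open import Relation.Binary.PropositionalEquality using (_≡_; _≢_)
open import Relation.Nullary using (¬_)
open import Function.Bundles using (_⇔_)

Vecℕ : ℕ → Set
Vecℕ d = Vec ℕ d

Mat : Set → ℕ → Set
Mat A d = Vec (Vec A d) d

_⊑_ : {d : ℕ} → Vecℕ d → Vecℕ d → Set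
_⊑_ {d} x y = (i : Fin d) → lookup x i ≤ lookup y i

-- u - a (componentwise truncated subtraction; only used when a ⊑ u)
_-ᵥ_ : {d : ℕ} → Vecℕ d → Vecℕ d → Vecℕ d
u -ᵥ a = zipWith _∸_ u a

_+ᵥ_ : {d : ℕ} → Vecℕ d → Vecℕ d → Vecℕ d
u +ᵥ a = zipWith _+_ u a

_·_ : {d : ℕ} → Mat ℕ d → Vecℕ d → Vecℕ d
A · v = map (λ row → sum (zipWith _*_ row v)) A

sumℚ : {n : ℕ} → Vec ℚ n → ℚ
sumℚ = foldr′ ℚ._+_ 0ℚ

toℚ : ℕ → ℚ
toℚ n = (+ n) ℚ./ 1

matℚ : {d : ℕ} → Mat ℕ d → Mat ℚ d
matℚ A = map (map toℚ) A

_×ℚ_ : {d : ℕ} → Mat ℚ d → Mat ℚ d → Mat ℚ d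
_×ℚ_ {d} A B = tabulate λ i → tabulate λ j →
  sumℚ (tabulate λ k → lookup (lookup A i) k ℚ.* lookup (lookup B k) j)

idℚ : {d : ℕ} → Mat ℚ d
idℚ {d} = tabulate λ i → tabulate λ j → δ i j
  where
  δ : {n : ℕ} → Fin n → Fin n → ℚ
  δ Fin.zero Fin.zero = 1ℚ
  δ Fin.zero (Fin.suc _) = 0ℚ
  δ (Fin.suc _) Fin.zero = 0ℚ
  δ (Fin.suc i) (Fin.suc j) = δ i j

InvertibleQ : {d : ℕ} → Mat ℕ d → Set
InvertibleQ {d} A = Σ (Mat ℚ d) λ B → (matℚ A ×ℚ B ≡ idℚ) × (B ×ℚ matℚ A ≡ idℚ)

Triple : ℕ → Set
Triple d = Vecℕ d × Mat ℕ d × Vecℕ d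

AffineNet : ℕ → Set
AffineNet d = List (Triple d)

Invertible : {d : ℕ} → AffineNet d → Set
Invertible {d} N = (a : Vecℕ d) (A : Mat ℕ d) (b : Vecℕ d) → (a , A , b) ∈ N → InvertibleQ A

Step : {d : ℕ} → AffineNet d → Vecℕ d → Vecℕ d → Set
Step {d} N u y = Σ (Vecℕ d) λ a → Σ (Mat ℕ d) λ A → Σ (Vecℕ d) λ b →
  ((a , A , b) ∈ N) × (a ⊑ u) × (y ≡ (A · (u -ᵥ a)) +ᵥ b)

Subset : ℕ → Set₁
Subset d = Vecℕ d → Set

PreAll : {d : ℕ} → AffineNet d → Subset d → Subset d
PreAll N S x = ∀ y → Step N x y → S y

chain : {d : ℕ} → AffineNet d → Vecℕ d → ℕ → Subset d
chain N t zero x = ¬ (t ⊑ x)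
chain N t (suc k) x = chain N t k x × PreAll N (chain N t k) x

-- Ideals, identified with vectors in (ℕ ∪ {ω})^d

data ℕω : Set where
  fin : ℕ → ℕω
  ω   : ℕω

data _≤ω_ : ℕω → ℕω → Set where
  fin≤fin : {m n : ℕ} → m ≤ n → fin m ≤ω fin n
  ≤ω-top  : {x : ℕω} → x ≤ω ω

Ideal : ℕ → Set
Ideal d = Vec ℕω d

_∈I_ : {d : ℕ} → Vecℕ d → Ideal d → Set
_∈I_ {d} x I = (i : Fin d) → fin (lookup x i) ≤ω lookup I i

_⊆I_ : {d : ℕ} → Ideal d → Ideal d → Set
_⊆I_ {d} I J = (i : Fin d) → lookup I i ≤ω lookup J i

isω : ℕω → ℕ
isω (fin _) = 0
isω ω = 1

dim : {d : ℕ} → Ideal d → ℕ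
dim I = sum (map isω I)

Incomparable : {d : ℕ} → Ideal d → Ideal d → Set
Incomparable I J = ¬ (I ⊆I J) × ¬ (J ⊆I I)

IsCanonicalDecomposition : {d : ℕ} → List (Ideal d) → Subset d → Set
IsCanonicalDecomposition L D =
  AllPairs Incomparable L × (∀ x → D x ⇔ Any (λ I → x ∈I I) L)

_∈D_ : {d : ℕ} → Ideal d → Subset d → Set
_∈D_ {d} I D = Σ (List (Ideal d)) λ L → IsCanonicalDecomposition L D × (I ∈ L)

Proper : {d : ℕ} → AffineNet d → Vecℕ d → ℕ → Ideal d → Set
Proper N t k I = (I ∈D chain N t k) × ¬ (I ∈D chain N t (suc k))

StronglyMonotone : {d : ℕ} → AffineNet d → Vecℕ d → Set
StronglyMonotone {d} N t = (k : ℕ) (I : Ideal d) → Proper N t (suc k) I →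
  Σ (Ideal d) λ I′ → Proper N t k I′ × (dim I ≤ dim I′)

-- Every Dₖ is the complement of a finitely generated upward-closed set, so it is decidable
-- and has a canonical decomposition. Let I be proper at step k+1. If I were contained in
-- D_{k+2}, it would also be a component of D_{k+2}; so some b ∈ I lies outside D_{k+2}, i.e. some
-- transition τ : u ↦ A(u - a) + b′ fires at b and leaves D_{k+1}. Moving b far out along the
-- ω-directions of I gives x ∈ I ⊆ D_{k+1}, so τ x lies in a component J of Dₖ, and J is
-- proper at step k because τ x ⊒ τ b ∉ D_{k+1}. Each row of A with a nonzero entry in an
-- ω-column of I makes the corresponding entry of τ x exceed every finite entry of the
-- components of Dₖ, so J is ω there. The ω-columns of I are thus supported on the ω-rows of J,
-- and since A is invertible over ℚ there are at most as many of them: dim I ≤ dim J.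
module Submission where

open import Defs
open import Algebra.Bundles using (CommutativeRing)
open import Data.Empty using (⊥-elim)
open import Data.Fin as Fin using (Fin)
open import Data.Fin.Properties using (all?; any?)
open import Data.Fin.Subset using (∣_∣; inside; outside; _-_; ⁅_⁆)
  renaming (Subset to FinSet; _∈_ to _∈ₛ_; _∉_ to _∉ₛ_)
open import Data.Fin.Subset.Properties
  using (_∈?_; nonempty?; Empty-unique; ∣⊥∣≡0; ∣p∣≤∣x∷p∣; p─q⊆p; p─⊥≡p; drop-there)
open import Data.List as List using (List; []; _∷_; _++_; filter; concatMap; cartesianProductWith; upTo; deduplicate)
open import Data.List.Membership.Propositional using (_∈_; find; lose)
open import Data.List.Membership.Propositional.Properties
  using (∈-cartesianProductWith⁺; ∈-upTo⁺; ∈-filter⁺; ∈-filter⁻; ∈-map⁺; ∈-deduplicate⁺; ∈-deduplicate⁻)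
open import Data.List.Relation.Unary.All as All using (All; []; _∷_)
open import Data.List.Relation.Unary.All.Properties using (¬All⇒Any¬)
open import Data.List.Relation.Unary.AllPairs using (AllPairs; []; _∷_)
open import Data.List.Relation.Unary.Any as Any using (Any; here; there)
open import Data.List.Relation.Unary.Any.Properties using (++⁺ˡ; ++⁺ʳ; ++⁻; concatMap⁺; concatMap⁻)
open import Data.List.Relation.Unary.Unique.DecPropositional.Properties using (deduplicate-!)
open import Data.Nat using (ℕ; zero; suc; _+_; _*_; _∸_; _≤_; _<_; _≤?_; _<?_; _⊓_; z≤n; s≤s; s≤s⁻¹)
open import Data.Nat.Properties
open import Data.Product using (_×_; _,_; proj₁; proj₂; ∃-syntax; swap)
open import Data.Rational as ℚ using (ℚ; 0ℚ; 1ℚ)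
import Data.Rational.Properties as ℚ
open import Data.Rational.Solver using (module +-*-Solver)
open import Data.Sum using (_⊎_; inj₁; inj₂)
open import Data.Vec as Vec using (Vec; []; _∷_; lookup; zipWith; map; sum; tabulate)
open import Data.Vec.Properties using (lookup-map; lookup-zipWith; lookup∘tabulate; ≡-dec)
open import Function using (_∘_)
open import Function.Bundles using (mk⇔; Equivalence)
open import Relation.Binary.Definitions using (Reflexive; Transitive; Decidable; DecidableEquality)
open import Relation.Binary.PropositionalEquality
  using (_≡_; _≢_; refl; sym; trans; cong; cong₂; subst; module ≡-Reasoning)
open import Relation.Nullary using (¬_; Dec; yes; no)
open import Relation.Nullary.Decidable using (_×-dec_; _→-dec_; ¬?)
open import Relation.Unary as U using (∁; _≐′_)

open import Algebra.Properties.Semiring.Sum (CommutativeRing.semiring ℚ.+-*-commutativeRing)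
  using (sum-syntax; ∑-distrib-+; ∑-comm; *-distribˡ-sum; *-distribʳ-sum; sum-cong-≗; sum-replicate-zero)
  renaming (sum to ∑)

private
  variable
    d m n : ℕ

vecsOver : {A : Set} → List A → (n : ℕ) → List (Vec A n)
vecsOver xs zero = [] ∷ []
vecsOver xs (suc n) = cartesianProductWith _∷_ xs (vecsOver xs n)

∈-vecsOver⁺ : {A : Set} {xs : List A} (v : Vec A n) → (∀ i → lookup v i ∈ xs) → v ∈ vecsOver xs n
∈-vecsOver⁺ [] _ = here refl
∈-vecsOver⁺ (x ∷ v) v⊆xs = ∈-cartesianProductWith⁺ _∷_ (v⊆xs Fin.zero) (∈-vecsOver⁺ v (v⊆xs ∘ Fin.suc))

Maximal : {A : Set} (_≼_ : A → A → Set) → List A → A → Set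
Maximal _≼_ xs m = All (λ z → m ≼ z → z ≼ m) xs

Maximal? : {A : Set} {_≼_ : A → A → Set} → Decidable _≼_ → (xs : List A) (m : A) → Dec (Maximal _≼_ xs m)
Maximal? _≼?_ xs m = All.all? (λ z → (m ≼? z) →-dec (z ≼? m)) xs

module _ {A : Set} {_≼_ : A → A → Set}
         (≼-refl : Reflexive _≼_) (≼-trans : Transitive _≼_) (_≼?_ : Decidable _≼_) where

  maximal-above′ : (a : A) (xs : List A) → ∃[ m ] m ∈ a ∷ xs × a ≼ m × Maximal _≼_ (a ∷ xs) m
  maximal-above′ a [] = a , here refl , ≼-refl , (λ _ → ≼-refl) ∷ []
  maximal-above′ a (y ∷ ys) with maximal-above′ a ys
  ... | m , m∈ , a≼m , a≼ ∷ ys≼ with m ≼? y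
  ...   | no m⋠y = m , weaken m∈ , a≼m , a≼ ∷ (λ m≼y → ⊥-elim (m⋠y m≼y)) ∷ ys≼
    where
    weaken : m ∈ a ∷ ys → m ∈ a ∷ y ∷ ys
    weaken (here m≡a) = here m≡a
    weaken (there m∈ys) = there (there m∈ys)
  ...   | yes m≼y with maximal-above′ y ys
  ...     | m′ , m′∈ , y≼m′ , max′ = m′ , there m′∈ , a≼m′ , (λ _ → a≼m′) ∷ max′
    where a≼m′ = ≼-trans a≼m (≼-trans m≼y y≼m′)

  maximal-above : {a : A} {xs : List A} → a ∈ xs → ∃[ m ] m ∈ xs × a ≼ m × Maximal _≼_ xs m
  maximal-above {a} {xs} a∈xs with maximal-above′ a xs
  ... | m , here refl , a≼m , _ ∷ max = m , a∈xs , a≼m , max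
  ... | m , there m∈xs , a≼m , _ ∷ max = m , m∈xs , a≼m , max

AllPairs-strengthen : {A : Set} {P : A → Set} {R S : A → A → Set} {xs : List A} →
  (∀ {x y} → P x → P y → R x y → S x y) → All P xs → AllPairs R xs → AllPairs S xs
AllPairs-strengthen f [] [] = []
AllPairs-strengthen f (px ∷ pxs) (rxs ∷ rs) =
  All.zipWith (λ (py , rxy) → f px py rxy) (pxs , rxs) ∷ AllPairs-strengthen f pxs rs

-- Vectors over ℕ and transitions

⊑-refl : {x : Vecℕ d} → x ⊑ x
⊑-refl i = ≤-refl

⊑-trans : {x y z : Vecℕ d} → x ⊑ y → y ⊑ z → x ⊑ z
⊑-trans x⊑y y⊑z i = ≤-trans (x⊑y i) (y⊑z i)

_⊑?_ : (x y : Vecℕ d) → Dec (x ⊑ y)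
x ⊑? y = all? λ i → lookup x i ≤? lookup y i

lookup≤sum : (v : Vec ℕ n) (i : Fin n) → lookup v i ≤ sum v
lookup≤sum (x ∷ v) Fin.zero = m≤m+n x (sum v)
lookup≤sum (x ∷ v) (Fin.suc i) = ≤-trans (lookup≤sum v i) (m≤n+m (sum v) x)

bound : List (Vecℕ d) → ℕ
bound [] = 0
bound (b ∷ B) = sum b + bound B

∈⇒lookup≤bound : {B : List (Vecℕ d)} {b : Vecℕ d} → b ∈ B → (i : Fin d) → lookup b i ≤ bound B
∈⇒lookup≤bound {B = b ∷ B} (here refl) i = ≤-trans (lookup≤sum b i) (m≤m+n (sum b) (bound B))
∈⇒lookup≤bound {B = b ∷ B} (there b′∈B) i = ≤-trans (∈⇒lookup≤bound b′∈B i) (m≤n+m (bound B) (sum b))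

lookup-+ᵥ : (x y : Vecℕ d) (i : Fin d) → lookup (x +ᵥ y) i ≡ lookup x i + lookup y i
lookup-+ᵥ x y i = lookup-zipWith _+_ i x y

+ᵥ-∸ᵥ : (a w : Vecℕ d) → (a +ᵥ w) -ᵥ a ≡ w
+ᵥ-∸ᵥ [] [] = refl
+ᵥ-∸ᵥ (a ∷ as) (w ∷ ws) = cong₂ _∷_ (m+n∸m≡n a w) (+ᵥ-∸ᵥ as ws)

dot : Vec ℕ n → Vec ℕ n → ℕ
dot r v = sum (zipWith _*_ r v)

dot-monoʳ-⊑ : (r : Vec ℕ n) {v w : Vec ℕ n} → v ⊑ w → dot r v ≤ dot r w
dot-monoʳ-⊑ [] {[]} {[]} _ = ≤-refl
dot-monoʳ-⊑ (r ∷ rs) {v ∷ vs} {w ∷ ws} v⊑w =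
  +-mono-≤ (*-monoʳ-≤ r (v⊑w Fin.zero)) (dot-monoʳ-⊑ rs (v⊑w ∘ Fin.suc))

*≤dot : (r v : Vec ℕ n) (j : Fin n) → lookup r j * lookup v j ≤ dot r v
*≤dot (r ∷ rs) (v ∷ vs) Fin.zero = m≤m+n (r * v) (dot rs vs)
*≤dot (r ∷ rs) (v ∷ vs) (Fin.suc j) = ≤-trans (*≤dot rs vs j) (m≤n+m (dot rs vs) (r * v))

dot-⊓ : (r v : Vec ℕ n) (M : ℕ) → dot r v ⊓ M ≤ dot r (map (_⊓ M) v)
dot-⊓ [] [] M = z≤n
dot-⊓ (zero ∷ rs) (v ∷ vs) M = dot-⊓ rs vs M
dot-⊓ (suc r ∷ rs) (v ∷ vs) M with ≤-total v M
... | inj₁ v≤M rewrite m≤n⇒m⊓n≡m v≤M = begin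
  (suc r * v + dot rs vs) ⊓ M             ≤⟨ ⊓-monoʳ-≤ (suc r * v + dot rs vs) (m≤n+m M (suc r * v)) ⟩
  (suc r * v + dot rs vs) ⊓ (suc r * v + M) ≡⟨ +-distribˡ-⊓ (suc r * v) (dot rs vs) M ⟨
  suc r * v + dot rs vs ⊓ M                ≤⟨ +-monoʳ-≤ (suc r * v) (dot-⊓ rs vs M) ⟩
  suc r * v + dot rs (map (_⊓ M) vs)       ∎
  where open ≤-Reasoning
... | inj₂ M≤v rewrite m≥n⇒m⊓n≡n M≤v =
  ≤-trans (m⊓n≤n _ M) (≤-trans (m≤m+n M (r * M)) (m≤m+n (suc r * M) _))

apply : Triple d → Vecℕ d → Vecℕ d
apply (a , A , b) x = (A · (x -ᵥ a)) +ᵥ b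

lookup-apply : (a : Vecℕ d) (A : Mat ℕ d) (b x : Vecℕ d) (i : Fin d) →
  lookup (apply (a , A , b) x) i ≡ dot (lookup A i) (x -ᵥ a) + lookup b i
lookup-apply a A b x i = trans (lookup-zipWith _+_ i (A · (x -ᵥ a)) b)
  (cong (_+ lookup b i) (lookup-map i (λ row → dot row (x -ᵥ a)) A))

lookup-∸ᵥ : (x a : Vecℕ d) (i : Fin d) → lookup (x -ᵥ a) i ≡ lookup x i ∸ lookup a i
lookup-∸ᵥ x a i = lookup-zipWith _∸_ i x a

∸ᵥ-monoˡ-⊑ : (a : Vecℕ d) {x y : Vecℕ d} → x ⊑ y → (x -ᵥ a) ⊑ (y -ᵥ a)
∸ᵥ-monoˡ-⊑ a {x} {y} x⊑y i rewrite lookup-∸ᵥ x a i | lookup-∸ᵥ y a i = ∸-monoˡ-≤ (lookup a i) (x⊑y i)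

apply-mono : (τ : Triple d) {x y : Vecℕ d} → x ⊑ y → apply τ x ⊑ apply τ y
apply-mono (a , A , b) {x} {y} x⊑y i rewrite lookup-apply a A b x i | lookup-apply a A b y i =
  +-monoˡ-≤ (lookup b i) (dot-monoʳ-⊑ (lookup A i) (∸ᵥ-monoˡ-⊑ a {x} {y} x⊑y))

∸≤lookup-apply : (a : Vecℕ d) (A : Mat ℕ d) (b x : Vecℕ d) (i j : Fin d) → 0 < lookup (lookup A i) j →
  lookup x j ∸ lookup a j ≤ lookup (apply (a , A , b) x) i
∸≤lookup-apply a A b x i j 0<Aᵢⱼ = begin
  lookup x j ∸ lookup a j                 ≡⟨ lookup-∸ᵥ x a j ⟨
  lookup (x -ᵥ a) j                       ≡⟨ *-identityˡ _ ⟨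
  1 * lookup (x -ᵥ a) j                   ≤⟨ *-monoˡ-≤ (lookup (x -ᵥ a) j) 0<Aᵢⱼ ⟩
  lookup (lookup A i) j * lookup (x -ᵥ a) j ≤⟨ *≤dot (lookup A i) (x -ᵥ a) j ⟩
  dot (lookup A i) (x -ᵥ a)               ≤⟨ m≤m+n _ (lookup b i) ⟩
  dot (lookup A i) (x -ᵥ a) + lookup b i  ≡⟨ lookup-apply a A b x i ⟨
  lookup (apply (a , A , b) x) i          ∎
  where open ≤-Reasoning

-- Upward-closed sets and the chain

↑_ : List (Vecℕ d) → Subset d
(↑ B) x = Any (_⊑ x) B

↑? : (B : List (Vecℕ d)) → U.Decidable (↑ B)
↑? B x = Any.any? (_⊑? x) B

∁↑-downward : (B : List (Vecℕ d)) {x y : Vecℕ d} → y ⊑ x → ∁ (↑ B) x → ∁ (↑ B) y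
∁↑-downward B {x} {y} y⊑x x∉↑B y∈↑B =
  x∉↑B (Any.map (λ {b} b⊑y → ⊑-trans {x = b} {y} {x} b⊑y y⊑x) y∈↑B)

FiresInto : Triple d → Vecℕ d → Subset d
FiresInto τ c x = proj₁ τ ⊑ x × c ⊑ apply τ x

preimageBasis : Triple d → Vecℕ d → List (Vecℕ d)
preimageBasis {d} τ c =
  filter (λ z → (proj₁ τ ⊑? z) ×-dec (c ⊑? apply τ z)) (vecsOver (upTo (suc (sum (proj₁ τ) + sum c))) d)

-- The basis element below x is a + min(x - a, ∑ c): capping the entries of x - a at ∑ c
-- lowers no entry of τ x below the minimum of its old value and ∑ c, which still bounds c.
preimageBasis-complete : (τ : Triple d) (c x : Vecℕ d) → FiresInto τ c x → (↑ preimageBasis τ c) x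
preimageBasis-complete τ@(a , A , b) c x (a⊑x , c⊑τx) =
  lose (∈-filter⁺ _ (∈-vecsOver⁺ z z-bounded) (a⊑z , c⊑τz)) z⊑x
  where
  M = sum c
  w = map (_⊓ M) (x -ᵥ a)
  z = a +ᵥ w
  lookup-w : ∀ j → lookup w j ≡ (lookup x j ∸ lookup a j) ⊓ M
  lookup-w j = trans (lookup-map j (_⊓ M) (x -ᵥ a)) (cong (_⊓ M) (lookup-∸ᵥ x a j))
  z-bounded : ∀ j → lookup z j ∈ upTo (suc (sum a + M))
  z-bounded j rewrite lookup-+ᵥ a w j | lookup-w j =
    ∈-upTo⁺ (s≤s (+-mono-≤ (lookup≤sum a j) (m⊓n≤n _ M)))
  a⊑z : a ⊑ z
  a⊑z j rewrite lookup-+ᵥ a w j = m≤m+n (lookup a j) (lookup w j)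
  z⊑x : z ⊑ x
  z⊑x j rewrite lookup-+ᵥ a w j | lookup-w j =
    ≤-trans (+-monoʳ-≤ (lookup a j) (m⊓n≤m _ M)) (≤-reflexive (m+[n∸m]≡n (a⊑x j)))
  c⊑τz : c ⊑ apply τ z
  c⊑τz i rewrite lookup-apply a A b z i | +ᵥ-∸ᵥ a w = begin
    lookup c i
      ≤⟨ ⊓-glb (≤-trans (c⊑τx i) (≤-reflexive (lookup-apply a A b x i)))
               (≤-trans (lookup≤sum c i) (m≤m+n M (lookup b i))) ⟩
    (dot (lookup A i) (x -ᵥ a) + lookup b i) ⊓ (M + lookup b i)
      ≡⟨ +-distribʳ-⊓ (lookup b i) _ M ⟨
    dot (lookup A i) (x -ᵥ a) ⊓ M + lookup b i
      ≤⟨ +-monoˡ-≤ (lookup b i) (dot-⊓ (lookup A i) (x -ᵥ a) M) ⟩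
    dot (lookup A i) w + lookup b i
      ∎
    where open ≤-Reasoning

preimageBasis-sound : (τ : Triple d) (c x : Vecℕ d) → (↑ preimageBasis τ c) x → FiresInto τ c x
preimageBasis-sound τ c x x∈↑P with find x∈↑P
... | z , z∈P , z⊑x with proj₂ (∈-filter⁻ _ {xs = vecsOver _ _} z∈P)
... | a⊑z , c⊑τz =
  ⊑-trans {x = proj₁ τ} {z} {x} a⊑z z⊑x , ⊑-trans {x = c} {apply τ z} {apply τ x} c⊑τz (apply-mono τ {z} {x} z⊑x)

preimages : AffineNet d → List (Vecℕ d) → List (Vecℕ d)
preimages N B = concatMap (λ τ → concatMap (preimageBasis τ) B) N

∩PreAll-≐′ : (N : AffineNet d) (S : Subset d) (B : List (Vecℕ d)) →
  S ≐′ ∁ (↑ B) → (S U.∩ PreAll N S) ≐′ ∁ (↑ (B ++ preimages N B))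
∩PreAll-≐′ N S B (S⊆∁↑B , ∁↑B⊆S) = sound , complete
  where
  sound : (S U.∩ PreAll N S) U.⊆′ ∁ (↑ (B ++ preimages N B))
  sound x (x∈S , pre) x∈↑ with ++⁻ B x∈↑
  ... | inj₁ x∈↑B = S⊆∁↑B x x∈S x∈↑B
  ... | inj₂ x∈↑P with find (concatMap⁻ (λ τ → concatMap (preimageBasis τ) B) {xs = N} x∈↑P)
  ... | τ@(a , A , b) , τ∈N , x∈↑Pτ with find (concatMap⁻ (preimageBasis τ) {xs = B} x∈↑Pτ)
  ... | c , c∈B , x∈↑Pτc with preimageBasis-sound τ c x x∈↑Pτc
  ... | a⊑x , c⊑τx = S⊆∁↑B (apply τ x) (pre (apply τ x) (a , A , b , τ∈N , a⊑x , refl)) (lose c∈B c⊑τx)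
  complete : ∁ (↑ (B ++ preimages N B)) U.⊆′ (S U.∩ PreAll N S)
  complete x x∉↑ = ∁↑B⊆S x (x∉↑ ∘ ++⁺ˡ) , pre
    where
    pre : PreAll N S x
    pre y (a , A , b , τ∈N , a⊑x , refl) = ∁↑B⊆S y λ y∈↑B →
      let c , c∈B , c⊑y = find y∈↑B
      in x∉↑ (++⁺ʳ B (concatMap⁺ _ (lose τ∈N (concatMap⁺ _ (lose c∈B
           (preimageBasis-complete (a , A , b) c x (a⊑x , c⊑y)))))))

module _ (N : AffineNet d) (t : Vecℕ d) where

  chainBasis : ℕ → List (Vecℕ d)
  chainBasis zero = t ∷ []
  chainBasis (suc k) = chainBasis k ++ preimages N (chainBasis k)

  chain≐′∁↑ : (k : ℕ) → chain N t k ≐′ ∁ (↑ chainBasis k)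
  chain≐′∁↑ zero = (λ x t⋢x x∈↑ → t⋢x (↑[t]⇒t⊑ x x∈↑)) , λ x x∉↑ t⊑x → x∉↑ (here t⊑x)
    where
    ↑[t]⇒t⊑ : ∀ x → (↑ (t ∷ [])) x → t ⊑ x
    ↑[t]⇒t⊑ x (here t⊑x) = t⊑x
  chain≐′∁↑ (suc k) = ∩PreAll-≐′ N (chain N t k) (chainBasis k) (chain≐′∁↑ k)

¬PreAll⇒escapingStep : (N : AffineNet d) {S : Subset d} → U.Decidable S → {x : Vecℕ d} →
  ¬ PreAll N S x → ∃[ τ ] τ ∈ N × proj₁ τ ⊑ x × ¬ S (apply τ x)
¬PreAll⇒escapingStep N S? {x} ¬pre with All.all? (λ τ → (proj₁ τ ⊑? x) →-dec S? (apply τ x)) N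
... | yes stays = ⊥-elim (¬pre λ { y (a , A , b , τ∈N , a⊑x , refl) → All.lookup stays τ∈N a⊑x })
... | no ¬stays with find (¬All⇒Any¬ (λ τ → (proj₁ τ ⊑? x) →-dec S? (apply τ x)) N ¬stays)
...   | τ , τ∈N , escapes with proj₁ τ ⊑? x
...     | yes fires = τ , τ∈N , fires , λ lands → escapes (λ _ → lands)
...     | no ¬fires = ⊥-elim (escapes (λ fires → ⊥-elim (¬fires fires)))

-- Ideals and canonical decompositions

_≤ω?_ : (x y : ℕω) → Dec (x ≤ω y)
fin m ≤ω? fin n with m ≤? n
... | yes m≤n = yes (fin≤fin m≤n)
... | no m≰n = no λ { (fin≤fin m≤n) → m≰n m≤n }
fin m ≤ω? ω = yes ≤ω-top
ω ≤ω? fin n = no λ ()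
ω ≤ω? ω = yes ≤ω-top

≤ω-refl : {x : ℕω} → x ≤ω x
≤ω-refl {fin n} = fin≤fin ≤-refl
≤ω-refl {ω} = ≤ω-top

≤ω-trans : {x y z : ℕω} → x ≤ω y → y ≤ω z → x ≤ω z
≤ω-trans (fin≤fin p) (fin≤fin q) = fin≤fin (≤-trans p q)
≤ω-trans _ ≤ω-top = ≤ω-top

≤ω-antisym : {x y : ℕω} → x ≤ω y → y ≤ω x → x ≡ y
≤ω-antisym (fin≤fin p) (fin≤fin q) = cong fin (≤-antisym p q)
≤ω-antisym ≤ω-top ≤ω-top = refl

_≟ω_ : DecidableEquality ℕω
fin m ≟ω fin n with m ≟ n
... | yes refl = yes refl
... | no m≢n = no λ { refl → m≢n refl }
fin m ≟ω ω = no λ ()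
ω ≟ω fin n = no λ ()
ω ≟ω ω = yes refl

_∈I?_ : (x : Vecℕ d) (I : Ideal d) → Dec (x ∈I I)
x ∈I? I = all? λ i → fin (lookup x i) ≤ω? lookup I i

_⊆I?_ : (I J : Ideal d) → Dec (I ⊆I J)
I ⊆I? J = all? λ i → lookup I i ≤ω? lookup J i

⊆I-refl : Reflexive (_⊆I_ {d})
⊆I-refl i = ≤ω-refl

⊆I-trans : Transitive (_⊆I_ {d})
⊆I-trans I⊆J J⊆K i = ≤ω-trans (I⊆J i) (J⊆K i)

⊆I-antisym : {I J : Ideal d} → I ⊆I J → J ⊆I I → I ≡ J
⊆I-antisym {I = []} {[]} _ _ = refl
⊆I-antisym {I = x ∷ I} {y ∷ J} I⊆J J⊆I =
  cong₂ _∷_ (≤ω-antisym (I⊆J Fin.zero) (J⊆I Fin.zero)) (⊆I-antisym (I⊆J ∘ Fin.suc) (J⊆I ∘ Fin.suc))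

∈I-⊆I : {x : Vecℕ d} {I J : Ideal d} → x ∈I I → I ⊆I J → x ∈I J
∈I-⊆I x∈I I⊆J i = ≤ω-trans (x∈I i) (I⊆J i)

∈I-⊑ : {x y : Vecℕ d} {I : Ideal d} → x ⊑ y → y ∈I I → x ∈I I
∈I-⊑ x⊑y y∈I i = ≤ω-trans (fin≤fin (x⊑y i)) (y∈I i)

cap : ℕ → ℕ → ℕω
cap M n with n ≤? M
... | yes _ = fin n
... | no _ = ω

fin≤ωcap : (M n : ℕ) → fin n ≤ω cap M n
fin≤ωcap M n with n ≤? M
... | yes _ = fin≤fin ≤-refl
... | no _ = ≤ω-top

cap-≤ : {M m n : ℕ} → m ≤ M → fin m ≤ω cap M n → m ≤ n
cap-≤ {M} {m} {n} m≤M m≤cap with n ≤? M | m≤cap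
... | yes _ | fin≤fin m≤n = m≤n
... | no n≰M | _ = ≤-trans m≤M (<⇒≤ (≰⇒> n≰M))

cap∈ : (M n : ℕ) → cap M n ∈ ω ∷ List.map fin (upTo (suc M))
cap∈ M n with n ≤? M
... | yes n≤M = there (∈-map⁺ fin (∈-upTo⁺ (s≤s n≤M)))
... | no _ = here refl

-- The complement of ↑B is covered by the ideals whose finite entries are at most
-- bound B; its components are the maximal ones among those that avoid B.
∁↑-decomposition : (B : List (Vecℕ d)) → ∃[ L ] IsCanonicalDecomposition L (∁ (↑ B))
∁↑-decomposition {d} B = components , pairwise , λ x → mk⇔ (cover x) (sound x)
  where
  M = bound B
  Avoids : Ideal d → Set
  Avoids I = All (λ b → ¬ b ∈I I) B
  candidates : List (Ideal d)
  candidates = filter (λ I → All.all? (λ b → ¬? (b ∈I? I)) B) (vecsOver (ω ∷ List.map fin (upTo (suc M))) d)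
  IsComponent : Ideal d → Set
  IsComponent I = I ∈ candidates × Maximal _⊆I_ candidates I
  components : List (Ideal d)
  components = deduplicate (≡-dec _≟ω_) (filter (Maximal? _⊆I?_ candidates) candidates)
  component : ∀ {I} → I ∈ components → IsComponent I
  component I∈ = ∈-filter⁻ _ {xs = candidates} (∈-deduplicate⁻ _ _ I∈)
  avoids : ∀ {I} → I ∈ candidates → Avoids I
  avoids I∈ = proj₂ (∈-filter⁻ _ {xs = vecsOver _ d} I∈)
  pairwise : AllPairs Incomparable components
  pairwise = AllPairs-strengthen incomparable (All.tabulate component) (deduplicate-! (≡-dec _≟ω_) _)
    where
    incomparable : ∀ {I J} → IsComponent I → IsComponent J → I ≢ J → Incomparable I J
    incomparable (I∈ , I-max) (J∈ , J-max) I≢J =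
      (λ I⊆J → I≢J (⊆I-antisym I⊆J (All.lookup I-max J∈ I⊆J))) ,
      (λ J⊆I → I≢J (⊆I-antisym (All.lookup J-max I∈ J⊆I) J⊆I))
  capped : Vecℕ d → Ideal d
  capped x = map (cap M) x
  lookup-capped : ∀ x i → lookup (capped x) i ≡ cap M (lookup x i)
  lookup-capped x i = lookup-map i (cap M) x
  x∈capped : ∀ x → x ∈I capped x
  x∈capped x i = subst (fin (lookup x i) ≤ω_) (sym (lookup-capped x i)) (fin≤ωcap M (lookup x i))
  capped∈ : ∀ x → ∁ (↑ B) x → capped x ∈ candidates
  capped∈ x x∉↑B =
    ∈-filter⁺ _ (∈-vecsOver⁺ (capped x) λ i → subst (_∈ _) (sym (lookup-capped x i)) (cap∈ M (lookup x i)))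
      (All.tabulate λ {b} b∈B b∈capped → x∉↑B (lose b∈B λ i →
        cap-≤ (∈⇒lookup≤bound b∈B i) (subst (fin (lookup b i) ≤ω_) (lookup-capped x i) (b∈capped i))))
  cover : ∀ x → ∁ (↑ B) x → Any (x ∈I_) components
  cover x x∉↑B
    with maximal-above (λ {I} → ⊆I-refl {x = I}) (λ {I J K} → ⊆I-trans {i = I} {J} {K}) _⊆I?_ (capped∈ x x∉↑B)
  ... | J , J∈ , capped⊆J , J-max =
    lose (∈-deduplicate⁺ _ (∈-filter⁺ _ J∈ J-max)) (∈I-⊆I {x = x} {capped x} {J} (x∈capped x) capped⊆J)
  sound : ∀ x → Any (x ∈I_) components → ∁ (↑ B) x
  sound x x∈L x∈↑B with find x∈L | find x∈↑B
  ... | J , J∈ , x∈J | b , b∈B , b⊑x =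
    All.lookup (avoids (proj₁ (component J∈))) b∈B (∈I-⊑ {x = b} {x} {J} b⊑x x∈J)

IsCanonicalDecomposition-≐′ : {L : List (Ideal d)} {D D′ : Subset d} →
  IsCanonicalDecomposition L D → D ≐′ D′ → IsCanonicalDecomposition L D′
IsCanonicalDecomposition-≐′ (pairwise , covers) (D⊆D′ , D′⊆D) =
  pairwise , λ x → mk⇔ (Equivalence.to (covers x) ∘ D′⊆D x) (D⊆D′ x ∘ Equivalence.from (covers x))

replaceω : ℕ → ℕω → ℕ
replaceω n (fin m) = m
replaceω n ω = n

corner : ℕ → Ideal d → Vecℕ d
corner n I = map (replaceω n) I

lookup-corner : (n : ℕ) (I : Ideal d) (i : Fin d) → lookup (corner n I) i ≡ replaceω n (lookup I i)
lookup-corner n I i = lookup-map i (replaceω n) I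

corner∈I : (n : ℕ) (I : Ideal d) → corner n I ∈I I
corner∈I n I i rewrite lookup-corner n I i with lookup I i
... | fin m = fin≤fin ≤-refl
... | ω = ≤ω-top

finBound : List (Ideal d) → ℕ
finBound L = bound (List.map (corner 0) L)

∈⇒fin≤finBound : {L : List (Ideal d)} {J : Ideal d} → J ∈ L →
  (i : Fin d) {m : ℕ} → lookup J i ≡ fin m → m ≤ finBound L
∈⇒fin≤finBound {J = J} J∈L i {m} Jᵢ≡m = subst (_≤ _) (trans (lookup-corner 0 J i) (cong (replaceω 0) Jᵢ≡m))
  (∈⇒lookup≤bound (∈-map⁺ (corner 0) J∈L) i)

replaceω-≤ω : (n : ℕ) (x y : ℕω) → (∀ {k} → y ≡ fin k → k < n) → fin (replaceω n x) ≤ω y → x ≤ω y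
replaceω-≤ω n (fin m) y _ m≤y = m≤y
replaceω-≤ω n ω ω _ _ = ≤ω-top
replaceω-≤ω n ω (fin k) k<n (fin≤fin n≤k) = ⊥-elim (<-irrefl refl (<-≤-trans (k<n refl) n≤k))

corner⇒⊆I : {L : List (Ideal d)} {n : ℕ} {I K : Ideal d} → finBound L < n → K ∈ L → corner n I ∈I K → I ⊆I K
corner⇒⊆I {n = n} {I} {K} L<n K∈L corner∈K i =
  replaceω-≤ω n (lookup I i) (lookup K i) (λ Kᵢ≡k → ≤-<-trans (∈⇒fin≤finBound K∈L i Kᵢ≡k) L<n)
    (subst (λ c → fin c ≤ω lookup K i) (lookup-corner n I i) (corner∈K i))

module _ {L : List (Ideal d)} {D : Subset d} (canonical : IsCanonicalDecomposition L D) where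

  component⊆ : {I : Ideal d} {x : Vecℕ d} → I ∈ L → x ∈I I → D x
  component⊆ {x = x} I∈L x∈I = Equivalence.from (proj₂ canonical x) (lose I∈L x∈I)

  covering-component : {x : Vecℕ d} → D x → ∃[ J ] J ∈ L × x ∈I J
  covering-component {x} x∈D = find (Equivalence.to (proj₂ canonical x) x∈D)

  component-⊆I⇒≡ : {I J : Ideal d} → I ∈ L → J ∈ L → I ⊆I J → I ≡ J
  component-⊆I⇒≡ = go (proj₁ canonical)
    where
    go : {L : List (Ideal d)} → AllPairs Incomparable L → {I J : Ideal d} → I ∈ L → J ∈ L → I ⊆I J → I ≡ J
    go (_ ∷ _) (here refl) (here refl) _ = refl
    go (I∦ ∷ _) (here refl) (there J∈) I⊆J = ⊥-elim (proj₁ (All.lookup I∦ J∈) I⊆J)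
    go (J∦ ∷ _) (there I∈) (here refl) I⊆J = ⊥-elim (proj₂ (All.lookup J∦ I∈) I⊆J)
    go (_ ∷ pairwise) (there I∈) (there J∈) I⊆J = go pairwise I∈ J∈ I⊆J

  ideal⊆component : {I : Ideal d} → (∀ x → x ∈I I → D x) → ∃[ J ] J ∈ L × I ⊆I J
  ideal⊆component {I} I⊆D with covering-component (I⊆D (corner far I) (corner∈I far I))
    where far = suc (finBound L)
  ... | J , J∈L , corner∈J = J , J∈L , corner⇒⊆I {I = I} {J} ≤-refl J∈L corner∈J

component-of-subset : {L L′ : List (Ideal d)} {D D′ : Subset d} →
  IsCanonicalDecomposition L D → IsCanonicalDecomposition L′ D′ →
  (∀ x → D′ x → D x) → {I : Ideal d} → I ∈ L → (∀ x → x ∈I I → D′ x) → I ∈ L′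
component-of-subset {L′ = L′} canonical canonical′ D′⊆D {I} I∈L I⊆D′
  with ideal⊆component canonical′ {I} I⊆D′
... | J , J∈L′ , I⊆J
  with ideal⊆component canonical {J} (λ x x∈J → D′⊆D x (component⊆ canonical′ {J} {x} J∈L′ x∈J))
...   | K , K∈L , J⊆K with component-⊆I⇒≡ canonical {I} {K} I∈L K∈L (⊆I-trans {i = I} {J} {K} I⊆J J⊆K)
...     | refl = subst (_∈ L′) (⊆I-antisym {I = J} {I} J⊆K I⊆J) J∈L′

ideal⊆∁↑⊎meets : (I : Ideal d) (B : List (Vecℕ d)) →
  (∀ x → x ∈I I → ∁ (↑ B) x) ⊎ (∃[ b ] b ∈I I × (↑ B) b)
ideal⊆∁↑⊎meets I B with Any.any? (_∈I? I) B
... | yes B∩I with find B∩I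
...   | b , b∈B , b∈I = inj₂ (b , b∈I , lose b∈B (⊑-refl {x = b}))
ideal⊆∁↑⊎meets I B | no B∩I=∅ = inj₁ λ x x∈I x∈↑B →
  let b , b∈B , b⊑x = find x∈↑B in B∩I=∅ (lose b∈B (∈I-⊑ {x = b} {x} {I} b⊑x x∈I))

module _ (N : AffineNet d) (t : Vecℕ d) (k : ℕ) where

  chain? : U.Decidable (chain N t k)
  chain? x with ↑? (chainBasis N t k) x
  ... | yes x∈↑ = no λ x∈D → proj₁ (chain≐′∁↑ N t k) x x∈D x∈↑
  ... | no x∉↑ = yes (proj₂ (chain≐′∁↑ N t k) x x∉↑)

  chain-downward : {x y : Vecℕ d} → y ⊑ x → chain N t k x → chain N t k y
  chain-downward {x} {y} y⊑x x∈D = proj₂ (chain≐′∁↑ N t k) y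
    (∁↑-downward (chainBasis N t k) {x} {y} y⊑x (proj₁ (chain≐′∁↑ N t k) x x∈D))

  chain-decomposition : ∃[ L ] IsCanonicalDecomposition L (chain N t k)
  chain-decomposition with ∁↑-decomposition (chainBasis N t k)
  ... | L , canonical = L , IsCanonicalDecomposition-≐′ canonical (swap (chain≐′∁↑ N t k))

  ideal⊆chain⊎escapes : (I : Ideal d) → (∀ x → x ∈I I → chain N t k x) ⊎ (∃[ b ] b ∈I I × ¬ chain N t k b)
  ideal⊆chain⊎escapes I with ideal⊆∁↑⊎meets I (chainBasis N t k)
  ... | inj₁ I⊆∁↑ = inj₁ λ x x∈I → proj₂ (chain≐′∁↑ N t k) x (I⊆∁↑ x x∈I)
  ... | inj₂ (b , b∈I , b∈↑) = inj₂ (b , b∈I , λ b∈D → proj₁ (chain≐′∁↑ N t k) b b∈D b∈↑)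

-- Linear algebra over ℚ

δ : Fin n → Fin n → ℚ
δ Fin.zero Fin.zero = 1ℚ
δ Fin.zero (Fin.suc _) = 0ℚ
δ (Fin.suc _) Fin.zero = 0ℚ
δ (Fin.suc i) (Fin.suc j) = δ i j

δ-diagonal : (i : Fin n) → δ i i ≡ 1ℚ
δ-diagonal Fin.zero = refl
δ-diagonal (Fin.suc i) = δ-diagonal i

δ-off-diagonal : (i j : Fin n) → i ≢ j → δ i j ≡ 0ℚ
δ-off-diagonal Fin.zero Fin.zero i≢j = ⊥-elim (i≢j refl)
δ-off-diagonal Fin.zero (Fin.suc j) _ = refl
δ-off-diagonal (Fin.suc i) Fin.zero _ = refl
δ-off-diagonal (Fin.suc i) (Fin.suc j) i≢j = δ-off-diagonal i j (i≢j ∘ cong Fin.suc)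

∑-zero : (f : Fin n → ℚ) → (∀ j → f j ≡ 0ℚ) → ∑ f ≡ 0ℚ
∑-zero {n} f f≡0 = trans (sum-cong-≗ f≡0) (sum-replicate-zero n)

∑-δ : (p : Fin n) (f : Fin n → ℚ) → ∑[ j < n ] (δ p j ℚ.* f j) ≡ f p
∑-δ Fin.zero f = trans (cong₂ ℚ._+_ (ℚ.*-identityˡ (f Fin.zero)) (∑-zero _ (λ j → ℚ.*-zeroˡ (f (Fin.suc j)))))
  (ℚ.+-identityʳ (f Fin.zero))
∑-δ (Fin.suc p) f =
  trans (cong₂ ℚ._+_ (ℚ.*-zeroˡ (f Fin.zero)) (∑-δ p (f ∘ Fin.suc))) (ℚ.+-identityˡ (f (Fin.suc p)))

x∉p-x : (p : FinSet n) (x : Fin n) → x ∉ₛ p - x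
x∉p-x (_ ∷ p) Fin.zero ()
x∉p-x (_ ∷ p) (Fin.suc x) = x∉p-x p x ∘ drop-there

suc∣p-x∣≡∣p∣ : {p : FinSet n} {x : Fin n} → x ∈ₛ p → suc ∣ p - x ∣ ≡ ∣ p ∣
suc∣p-x∣≡∣p∣ {p = inside ∷ p} Vec.here = cong suc (cong ∣_∣ (p─⊥≡p p))
suc∣p-x∣≡∣p∣ {p = inside ∷ p} (Vec.there x∈p) = cong suc (suc∣p-x∣≡∣p∣ x∈p)
suc∣p-x∣≡∣p∣ {p = outside ∷ p} (Vec.there x∈p) = suc∣p-x∣≡∣p∣ x∈p

record Dependence (S : FinSet m) (v : Fin m → Fin n → ℚ) : Set where
  field
    coeff : Fin m → ℚ
    supported : ∀ {j} → j ∉ₛ S → coeff j ≡ 0ℚ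
    witness : Fin m
    witness-nonzero : coeff witness ≢ 0ℚ
    combination-zero : ∀ i → ∑[ j < m ] (coeff j ℚ.* v j i) ≡ 0ℚ

dependence-in-ℚ⁰ : (S : FinSet m) (v : Fin m → Fin 0 → ℚ) → 0 < ∣ S ∣ → Dependence S v
dependence-in-ℚ⁰ {m} S v 0<∣S∣ with nonempty? S
... | no S=∅ = ⊥-elim (<-irrefl (trans (sym (∣⊥∣≡0 m)) (cong ∣_∣ (sym (Empty-unique S=∅)))) 0<∣S∣)
... | yes (q , q∈S) = record
  { coeff = δ q
  ; supported = λ {j} j∉S → δ-off-diagonal q j λ { refl → j∉S q∈S }
  ; witness = q
  ; witness-nonzero = λ δqq≡0 → ℚ.1≢0 (trans (sym (δ-diagonal q)) δqq≡0)
  ; combination-zero = λ ()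
  }

dependence-of-tails : (S : FinSet m) (v : Fin m → Fin (suc n) → ℚ) →
  (∀ {j} → j ∈ₛ S → v j Fin.zero ≡ 0ℚ) →
  Dependence S (λ j i → v j (Fin.suc i)) → Dependence S v
dependence-of-tails S v heads≡0 D = record
  { coeff = coeff
  ; supported = supported
  ; witness = witness
  ; witness-nonzero = witness-nonzero
  ; combination-zero = λ
    { Fin.zero → ∑-zero _ head-term≡0
    ; (Fin.suc i) → combination-zero i }
  }
  where
  open Dependence D
  head-term≡0 : ∀ j → coeff j ℚ.* v j Fin.zero ≡ 0ℚ
  head-term≡0 j with j ∈? S
  ... | yes j∈S = trans (cong (coeff j ℚ.*_) (heads≡0 j∈S)) (ℚ.*-zeroʳ (coeff j))
  ... | no j∉S = trans (cong (ℚ._* v j Fin.zero) (supported j∉S)) (ℚ.*-zeroˡ (v j Fin.zero))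

module _ (S : FinSet m) (v : Fin m → Fin (suc n) → ℚ)
         (p : Fin m) (p∈S : p ∈ₛ S) (pivot≢0 : v p Fin.zero ≢ 0ℚ) where

  private
    instance
      pivot-nonZero : ℚ.NonZero (v p Fin.zero)
      pivot-nonZero = ℚ.≢-nonZero pivot≢0

  ratio : Fin m → ℚ
  ratio j = v j Fin.zero ℚ.÷ v p Fin.zero

  eliminated : Fin m → Fin n → ℚ
  eliminated j i = v j (Fin.suc i) ℚ.- ratio j ℚ.* v p (Fin.suc i)

  eliminated⊆ : (R : FinSet n) → (∀ {j i} → j ∈ₛ S → i ∉ₛ inside ∷ R → v j i ≡ 0ℚ) →
    ∀ {j i} → j ∈ₛ S - p → i ∉ₛ R → eliminated j i ≡ 0ℚ
  eliminated⊆ R v⊆R {j} {i} j∈S-p i∉R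
    rewrite v⊆R (p─q⊆p S ⁅ p ⁆ j∈S-p) (i∉R ∘ drop-there) | v⊆R p∈S (i∉R ∘ drop-there) =
    cong (λ e → 0ℚ ℚ.- e) (ℚ.*-zeroʳ (ratio j))

  -- The eliminated vectors are v j - ratio j · v p with the (now zero) first entry dropped,
  -- so a relation μ among them lifts to μ - (∑ⱼ μⱼ ratio j) δ p among the v j.
  dependence-of-eliminated : Dependence (S - p) eliminated → Dependence S v
  dependence-of-eliminated D = record
    { coeff = coeff′
    ; supported = supported′
    ; witness = witness
    ; witness-nonzero = λ coeff′w≡0 → witness-nonzero (trans (sym (coeff′-off-pivot witness witness≢p)) coeff′w≡0)
    ; combination-zero = combination-zero′
    }
    where
    open Dependence D
    open +-*-Solver
    C = ∑[ j < m ] (coeff j ℚ.* ratio j)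
    coeff′ : Fin m → ℚ
    coeff′ j = coeff j ℚ.+ ℚ.- C ℚ.* δ p j
    coeff′-off-pivot : ∀ j → j ≢ p → coeff′ j ≡ coeff j
    coeff′-off-pivot j j≢p = trans (cong (λ e → coeff j ℚ.+ ℚ.- C ℚ.* e) (δ-off-diagonal p j (j≢p ∘ sym)))
      (trans (cong (coeff j ℚ.+_) (ℚ.*-zeroʳ (ℚ.- C))) (ℚ.+-identityʳ (coeff j)))
    witness≢p : witness ≢ p
    witness≢p refl = witness-nonzero (supported (x∉p-x S p))
    supported′ : ∀ {j} → j ∉ₛ S → coeff′ j ≡ 0ℚ
    supported′ {j} j∉S = trans (coeff′-off-pivot j j≢p) (supported (j∉S ∘ p─q⊆p S ⁅ p ⁆))
      where
      j≢p : j ≢ p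
      j≢p refl = j∉S p∈S
    combination-lifted : ∀ i →
      ∑[ j < m ] (coeff′ j ℚ.* v j i) ≡ ∑[ j < m ] (coeff j ℚ.* (v j i ℚ.- ratio j ℚ.* v p i))
    combination-lifted i = begin
      ∑[ j < m ] (coeff′ j ℚ.* v j i)
        ≡⟨ sum-cong-≗ (λ j → solve 4 (λ μ k e x → (μ :+ k :* e) :* x := μ :* x :+ k :* (e :* x)) refl
                                       (coeff j) (ℚ.- C) (δ p j) (v j i)) ⟩
      ∑[ j < m ] (coeff j ℚ.* v j i ℚ.+ ℚ.- C ℚ.* (δ p j ℚ.* v j i))
        ≡⟨ ∑-distrib-+ {m} μv (λ j → ℚ.- C ℚ.* (δ p j ℚ.* v j i)) ⟩
      ∑ μv ℚ.+ ∑[ j < m ] (ℚ.- C ℚ.* (δ p j ℚ.* v j i))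
        ≡⟨ cong (∑ μv ℚ.+_) (trans (sym (*-distribˡ-sum (ℚ.- C) (λ j → δ p j ℚ.* v j i)))
                                    (cong (ℚ.- C ℚ.*_) (∑-δ p (λ j → v j i)))) ⟩
      ∑ μv ℚ.+ ℚ.- C ℚ.* v p i
        ≡⟨ cong (∑ μv ℚ.+_) (solve 2 (λ c w → (:- c) :* w := (:- w) :* c) refl C (v p i)) ⟩
      ∑ μv ℚ.+ ℚ.- v p i ℚ.* C
        ≡⟨ cong (∑ μv ℚ.+_) (*-distribˡ-sum (ℚ.- v p i) (λ j → coeff j ℚ.* ratio j)) ⟩
      ∑ μv ℚ.+ ∑[ j < m ] (ℚ.- v p i ℚ.* (coeff j ℚ.* ratio j))
        ≡⟨ ∑-distrib-+ {m} μv (λ j → ℚ.- v p i ℚ.* (coeff j ℚ.* ratio j)) ⟨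
      ∑[ j < m ] (coeff j ℚ.* v j i ℚ.+ ℚ.- v p i ℚ.* (coeff j ℚ.* ratio j))
        ≡⟨ sum-cong-≗ (λ j → solve 4 (λ μ x r w → μ :* x :+ (:- w) :* (μ :* r) := μ :* (x :- r :* w)) refl
                                       (coeff j) (v j i) (ratio j) (v p i)) ⟩
      ∑[ j < m ] (coeff j ℚ.* (v j i ℚ.- ratio j ℚ.* v p i))
        ∎
      where
      open ≡-Reasoning
      μv : Fin m → ℚ
      μv j = coeff j ℚ.* v j i
    head-eliminated : ∀ j → v j Fin.zero ℚ.- ratio j ℚ.* v p Fin.zero ≡ 0ℚ
    head-eliminated j = trans (cong (λ e → v j Fin.zero ℚ.- e) (trans (ℚ.*-assoc (v j Fin.zero) _ _)
      (trans (cong (v j Fin.zero ℚ.*_) (ℚ.*-inverseˡ (v p Fin.zero))) (ℚ.*-identityʳ (v j Fin.zero)))))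
      (ℚ.+-inverseʳ (v j Fin.zero))
    combination-zero′ : ∀ i → ∑[ j < m ] (coeff′ j ℚ.* v j i) ≡ 0ℚ
    combination-zero′ Fin.zero = trans (combination-lifted Fin.zero)
      (∑-zero _ λ j → trans (cong (coeff j ℚ.*_) (head-eliminated j)) (ℚ.*-zeroʳ (coeff j)))
    combination-zero′ (Fin.suc i) = trans (combination-lifted (Fin.suc i)) (combination-zero i)

∣support∣<∣S∣⇒Dependence : (S : FinSet m) (R : FinSet n) (v : Fin m → Fin n → ℚ) →
  (∀ {j i} → j ∈ₛ S → i ∉ₛ R → v j i ≡ 0ℚ) → ∣ R ∣ < ∣ S ∣ → Dependence S v
∣support∣<∣S∣⇒Dependence {n = zero} S [] v _ ∣R∣<∣S∣ = dependence-in-ℚ⁰ S v ∣R∣<∣S∣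
∣support∣<∣S∣⇒Dependence {m} {suc n} S (r ∷ R) v v⊆R ∣R∣<∣S∣
  with any? (λ j → (j ∈? S) ×-dec ¬? (v j Fin.zero ℚ.≟ 0ℚ))
... | no ¬pivot = dependence-of-tails S v (λ {j} j∈S → head≡0 j j∈S)
  (∣support∣<∣S∣⇒Dependence S R (λ j i → v j (Fin.suc i)) (λ j∈S i∉R → v⊆R j∈S (i∉R ∘ drop-there))
    (≤-<-trans (∣p∣≤∣x∷p∣ r R) ∣R∣<∣S∣))
  where
  head≡0 : ∀ j → j ∈ₛ S → v j Fin.zero ≡ 0ℚ
  head≡0 j j∈S with v j Fin.zero ℚ.≟ 0ℚ
  ... | yes vⱼ≡0 = vⱼ≡0
  ... | no vⱼ≢0 = ⊥-elim (¬pivot (j , j∈S , vⱼ≢0))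
... | yes (p , p∈S , pivot≢0) with r
...   | outside = ⊥-elim (pivot≢0 (v⊆R p∈S λ ()))
...   | inside = dependence-of-eliminated S v p p∈S pivot≢0
  (∣support∣<∣S∣⇒Dependence (S - p) R (eliminated S v p p∈S pivot≢0) (eliminated⊆ S v p p∈S pivot≢0 R v⊆R)
    (s≤s⁻¹ (subst (suc ∣ R ∣ <_) (sym (suc∣p-x∣≡∣p∣ p∈S)) ∣R∣<∣S∣)))

-- Both sides reduce to the Kronecker delta private to idℚ, which agrees with δ clause by clause.
lookup-idℚ : (i j : Fin d) → lookup (lookup idℚ i) j ≡ δ i j
lookup-idℚ Fin.zero Fin.zero = refl
lookup-idℚ Fin.zero (Fin.suc j) = lookup∘tabulate _ j
lookup-idℚ (Fin.suc i) Fin.zero = cong (λ row → lookup row Fin.zero) (lookup∘tabulate _ i)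
lookup-idℚ {suc d} (Fin.suc i) (Fin.suc j) = begin
  lookup (lookup idℚ (Fin.suc i)) (Fin.suc j) ≡⟨ cong (λ row → lookup row (Fin.suc j)) (lookup∘tabulate _ i) ⟩
  lookup (tabulate _) j                        ≡⟨ lookup∘tabulate _ j ⟩
  _                                            ≡⟨ lookup∘tabulate _ j ⟨
  lookup (tabulate _) j                        ≡⟨ cong (λ row → lookup row j) (lookup∘tabulate _ i) ⟨
  lookup (lookup (idℚ {d}) i) j                ≡⟨ lookup-idℚ i j ⟩
  δ i j                                        ∎
  where open ≡-Reasoning

sumℚ-tabulate : (f : Fin n → ℚ) → sumℚ (tabulate f) ≡ ∑ f
sumℚ-tabulate {zero} f = refl
sumℚ-tabulate {suc n} f = cong (f Fin.zero ℚ.+_) (sumℚ-tabulate (f ∘ Fin.suc))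

lookup-×ℚ-matℚ : (B : Mat ℚ d) (A : Mat ℕ d) (i j : Fin d) →
  lookup (lookup (B ×ℚ matℚ A) i) j ≡ ∑[ k < d ] (lookup (lookup B i) k ℚ.* toℚ (lookup (lookup A k) j))
lookup-×ℚ-matℚ {d} B A i j = begin
  lookup (lookup (B ×ℚ matℚ A) i) j
    ≡⟨ trans (cong (λ row → lookup row j) (lookup∘tabulate _ i)) (lookup∘tabulate _ j) ⟩
  sumℚ (tabulate λ k → lookup (lookup B i) k ℚ.* lookup (lookup (matℚ A) k) j)
    ≡⟨ sumℚ-tabulate (λ k → lookup (lookup B i) k ℚ.* lookup (lookup (matℚ A) k) j) ⟩
  ∑[ k < d ] (lookup (lookup B i) k ℚ.* lookup (lookup (matℚ A) k) j)
    ≡⟨ sum-cong-≗ (λ k → cong (lookup (lookup B i) k ℚ.*_)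
         (trans (cong (λ row → lookup row j) (lookup-map k (map toℚ) A)) (lookup-map j toℚ (lookup A k)))) ⟩
  ∑[ k < d ] (lookup (lookup B i) k ℚ.* toℚ (lookup (lookup A k) j))
    ∎
  where open ≡-Reasoning

invertible⇒columns-independent : {A : Mat ℕ d} → InvertibleQ A → {S : FinSet d} →
  ¬ Dependence S (λ j i → toℚ (lookup (lookup A i) j))
invertible⇒columns-independent {d} {A} (B , _ , BA≡I) D = witness-nonzero (begin
  coeff q
    ≡⟨ ∑-δ q coeff ⟨
  ∑[ j < d ] (δ q j ℚ.* coeff j)
    ≡⟨ sum-cong-≗ (λ j → cong (ℚ._* coeff j) (BA-entry j)) ⟨
  ∑[ j < d ] (∑[ k < d ] (Bq k ℚ.* a k j) ℚ.* coeff j)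
    ≡⟨ sum-cong-≗ (λ j → *-distribʳ-sum (coeff j) (λ k → Bq k ℚ.* a k j)) ⟩
  ∑[ j < d ] ∑[ k < d ] (Bq k ℚ.* a k j ℚ.* coeff j)
    ≡⟨ ∑-comm (λ j k → Bq k ℚ.* a k j ℚ.* coeff j) ⟩
  ∑[ k < d ] ∑[ j < d ] (Bq k ℚ.* a k j ℚ.* coeff j)
    ≡⟨ sum-cong-≗ factor-Bq ⟩
  ∑[ k < d ] (Bq k ℚ.* ∑[ j < d ] (coeff j ℚ.* a k j))
    ≡⟨ ∑-zero (λ k → Bq k ℚ.* ∑[ j < d ] (coeff j ℚ.* a k j)) Bq*0≡0 ⟩
  0ℚ
    ∎)
  where
  open Dependence D
  open ≡-Reasoning
  open +-*-Solver
  q = witness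
  Bq : Fin d → ℚ
  Bq = lookup (lookup B q)
  a : Fin d → Fin d → ℚ
  a k j = toℚ (lookup (lookup A k) j)
  BA-entry : ∀ j → ∑[ k < d ] (Bq k ℚ.* a k j) ≡ δ q j
  BA-entry j = trans (sym (lookup-×ℚ-matℚ B A q j)) (trans (cong (λ M → lookup (lookup M q) j) BA≡I) (lookup-idℚ q j))
  factor-Bq : ∀ k → ∑[ j < d ] (Bq k ℚ.* a k j ℚ.* coeff j) ≡ Bq k ℚ.* ∑[ j < d ] (coeff j ℚ.* a k j)
  factor-Bq k = trans (sum-cong-≗ λ j → solve 3 (λ b x c → b :* x :* c := b :* (c :* x)) refl (Bq k) (a k j) (coeff j))
    (sym (*-distribˡ-sum (Bq k) (λ j → coeff j ℚ.* a k j)))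
  Bq*0≡0 : ∀ k → Bq k ℚ.* ∑[ j < d ] (coeff j ℚ.* a k j) ≡ 0ℚ
  Bq*0≡0 k = trans (cong (Bq k ℚ.*_) (combination-zero k)) (ℚ.*-zeroʳ (Bq k))

invertible⇒∣S∣≤∣R∣ : (A : Mat ℕ d) → InvertibleQ A → (S R : FinSet d) →
  (∀ {j i} → j ∈ₛ S → i ∉ₛ R → lookup (lookup A i) j ≡ 0) → ∣ S ∣ ≤ ∣ R ∣
invertible⇒∣S∣≤∣R∣ A A-invertible S R A⊆R with ∣ R ∣ <? ∣ S ∣
... | no ∣R∣≮∣S∣ = ≮⇒≥ ∣R∣≮∣S∣
... | yes ∣R∣<∣S∣ = ⊥-elim (invertible⇒columns-independent {A = A} A-invertible {S}
  (∣support∣<∣S∣⇒Dependence S R (λ j i → toℚ (lookup (lookup A i) j))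
    (λ j∈S i∉R → cong toℚ (A⊆R j∈S i∉R)) ∣R∣<∣S∣))

ωCoords : Ideal d → FinSet d
ωCoords = map λ { (fin _) → outside ; ω → inside }

dim≡∣ωCoords∣ : (I : Ideal d) → dim I ≡ ∣ ωCoords I ∣
dim≡∣ωCoords∣ [] = refl
dim≡∣ωCoords∣ (fin _ ∷ I) = dim≡∣ωCoords∣ I
dim≡∣ωCoords∣ (ω ∷ I) = cong suc (dim≡∣ωCoords∣ I)

∈ωCoords⇒≡ω : {I : Ideal d} {j : Fin d} → j ∈ₛ ωCoords I → lookup I j ≡ ω
∈ωCoords⇒≡ω {I = ω ∷ I} Vec.here = refl
∈ωCoords⇒≡ω {I = _ ∷ I} (Vec.there j∈) = ∈ωCoords⇒≡ω j∈

∉ωCoords⇒fin : (J : Ideal d) (i : Fin d) → i ∉ₛ ωCoords J → ∃[ m ] lookup J i ≡ fin m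
∉ωCoords⇒fin (fin m ∷ J) Fin.zero _ = m , refl
∉ωCoords⇒fin (ω ∷ J) Fin.zero i∉ = ⊥-elim (i∉ Vec.here)
∉ωCoords⇒fin (_ ∷ J) (Fin.suc i) i∉ = ∉ωCoords⇒fin J i (i∉ ∘ Vec.there)

onω : ℕ → ℕω → ℕ
onω n (fin _) = 0
onω n ω = n

ω-shift : ℕ → Ideal d → Vecℕ d
ω-shift n = map (onω n)

ω-shift∈I : (n : ℕ) {I : Ideal d} {b : Vecℕ d} → b ∈I I → (b +ᵥ ω-shift n I) ∈I I
ω-shift∈I n {fin k ∷ I} {b ∷ bs} b∈I Fin.zero with b∈I Fin.zero
... | fin≤fin b≤k = fin≤fin (≤-trans (≤-reflexive (+-identityʳ b)) b≤k)
ω-shift∈I n {ω ∷ I} {b ∷ bs} _ Fin.zero = ≤ω-top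
ω-shift∈I n {_ ∷ I} {b ∷ bs} b∈I (Fin.suc j) = ω-shift∈I n {I} {bs} (b∈I ∘ Fin.suc) j

⊑+ω-shift : (n : ℕ) (I : Ideal d) (b : Vecℕ d) → b ⊑ (b +ᵥ ω-shift n I)
⊑+ω-shift n I b j rewrite lookup-+ᵥ b (ω-shift n I) j = m≤m+n (lookup b j) _

lookup-+ω-shift : (n : ℕ) (I : Ideal d) (b : Vecℕ d) {j : Fin d} →
  lookup I j ≡ ω → lookup (b +ᵥ ω-shift n I) j ≡ lookup b j + n
lookup-+ω-shift n I b {j} Iⱼ≡ω = trans (lookup-+ᵥ b (ω-shift n I) j)
  (cong (lookup b j +_) (trans (lookup-map j (onω n) I) (cong (onω n) Iⱼ≡ω)))

finite-row⇒entry≡0 : {L : List (Ideal d)} {J : Ideal d} → J ∈ L →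
  (a : Vecℕ d) (A : Mat ℕ d) (b x : Vecℕ d) → apply (a , A , b) x ∈I J →
  {S : FinSet d} → (∀ {j} → j ∈ₛ S → finBound L < lookup x j ∸ lookup a j) →
  ∀ {j i} → j ∈ₛ S → i ∉ₛ ωCoords J → lookup (lookup A i) j ≡ 0
finite-row⇒entry≡0 {L = L} {J} J∈L a A b x τx∈J far-out {j} {i} j∈S i∉ with ∉ωCoords⇒fin J i i∉
... | m , Jᵢ≡m with subst (fin (lookup (apply (a , A , b) x) i) ≤ω_) Jᵢ≡m (τx∈J i)
...   | fin≤fin τxᵢ≤m = n≤0⇒n≡0 (≮⇒≥ λ 0<Aᵢⱼ → <-irrefl refl (begin-strict
  m                                ≤⟨ ∈⇒fin≤finBound {L = L} J∈L i Jᵢ≡m ⟩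
  finBound L                       <⟨ far-out j∈S ⟩
  lookup x j ∸ lookup a j          ≤⟨ ∸≤lookup-apply a A b x i j 0<Aᵢⱼ ⟩
  lookup (apply (a , A , b) x) i   ≤⟨ τxᵢ≤m ⟩
  m                                ∎))
  where open ≤-Reasoning

module _ (N : AffineNet d) (t : Vecℕ d) (k : ℕ) {Lₖ : List (Ideal d)}
         (canonicalₖ : IsCanonicalDecomposition Lₖ (chain N t k)) where

  escaping-step⇒proper-component :
    {a : Vecℕ d} {A : Mat ℕ d} {b′ : Vecℕ d} → (a , A , b′) ∈ N → InvertibleQ A →
    {I : Ideal d} → (∀ x → x ∈I I → chain N t (suc k) x) →
    {b : Vecℕ d} → b ∈I I → a ⊑ b → ¬ chain N t (suc k) (apply (a , A , b′) b) →
    ∃[ J ] Proper N t k J × dim I ≤ dim J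
  escaping-step⇒proper-component {a} {A} {b′} τ∈N A-invertible {I} I⊆D₁ {b} b∈I a⊑b τb∉D₁ =
    J , ((Lₖ , canonicalₖ , J∈Lₖ) , J∉D₁) , dim-≤
    where
    τ = (a , A , b′)
    far = suc (finBound Lₖ)
    x = b +ᵥ ω-shift far I
    b⊑x = ⊑+ω-shift far I b
    y = apply τ x
    y∈Dₖ : chain N t k y
    y∈Dₖ = proj₂ (I⊆D₁ x (ω-shift∈I far {I} {b} b∈I)) y
      (a , A , b′ , τ∈N , ⊑-trans {x = a} {b} {x} a⊑b b⊑x , refl)
    y∉D₁ : ¬ chain N t (suc k) y
    y∉D₁ = τb∉D₁ ∘ chain-downward N t (suc k) {y} {apply τ b} (apply-mono τ {b} {x} b⊑x)
    J = proj₁ (covering-component canonicalₖ y∈Dₖ)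
    J∈Lₖ = proj₁ (proj₂ (covering-component canonicalₖ y∈Dₖ))
    y∈J = proj₂ (proj₂ (covering-component canonicalₖ y∈Dₖ))
    J∉D₁ : ¬ J ∈D chain N t (suc k)
    J∉D₁ (L , canonical , J∈L) = y∉D₁ (component⊆ canonical {J} {y} J∈L y∈J)
    far-out : ∀ {j} → j ∈ₛ ωCoords I → finBound Lₖ < lookup x j ∸ lookup a j
    far-out {j} j∈ = begin-strict
      finBound Lₖ                   <⟨ n<1+n (finBound Lₖ) ⟩
      far                           ≤⟨ m≤n+m far (lookup b j ∸ lookup a j) ⟩
      lookup b j ∸ lookup a j + far ≡⟨ +-∸-comm far (a⊑b j) ⟨
      lookup b j + far ∸ lookup a j ≡⟨ cong (_∸ lookup a j) (lookup-+ω-shift far I b (∈ωCoords⇒≡ω j∈)) ⟨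
      lookup x j ∸ lookup a j       ∎
      where open ≤-Reasoning
    dim-≤ : dim I ≤ dim J
    dim-≤ rewrite dim≡∣ωCoords∣ I | dim≡∣ωCoords∣ J =
      invertible⇒∣S∣≤∣R∣ A A-invertible (ωCoords I) (ωCoords J) (finite-row⇒entry≡0 J∈Lₖ a A b′ x y∈J far-out)

proposition4p11 : (d : ℕ) (N : AffineNet d) → Invertible N → (t : Vecℕ d) → StronglyMonotone N t
proposition4p11 d N N-invertible t k I ((L₁ , canonical₁ , I∈L₁) , I∉D₂) =
  proper-below (ideal⊆chain⊎escapes N t (suc (suc k)) I)
  where
  I⊆D₁ : ∀ x → x ∈I I → chain N t (suc k) x
  I⊆D₁ x = component⊆ canonical₁ {I} {x} I∈L₁
  proper-below : (∀ x → x ∈I I → chain N t (suc (suc k)) x) ⊎ (∃[ b ] b ∈I I × ¬ chain N t (suc (suc k)) b) →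
    ∃[ J ] Proper N t k J × dim I ≤ dim J
  proper-below (inj₁ I⊆D₂) =
    ⊥-elim (I∉D₂ (_ , canonical₂ , component-of-subset canonical₁ canonical₂ (λ _ → proj₁) I∈L₁ I⊆D₂))
    where canonical₂ = proj₂ (chain-decomposition N t (suc (suc k)))
  proper-below (inj₂ (b , b∈I , b∉D₂))
    with ¬PreAll⇒escapingStep N (chain? N t (suc k)) (b∉D₂ ∘ (I⊆D₁ b b∈I ,_))
  ... | (a , A , b′) , τ∈N , a⊑b , τb∉D₁ = escaping-step⇒proper-component N t k (proj₂ (chain-decomposition N t k))
    τ∈N (N-invertible a A b′ τ∈N) {I} I⊆D₁ {b} b∈I a⊑b τb∉D₁
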